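{- Let $\mathcal{G}=(V,E,\mathcal{E})$ be an extended graph and let $v\in V$ be 2-isolated in $\mathcal{G}$. Then $v$ is contained in some maximum 2-packing set of $\mathcal{G}$. Consequently, with $\mathcal{G}'=\mathcal{G}[V\setminus N^2[v]]$, we have $\beta(\mathcal{G})=\beta(\mathcal{G}')+1$.
   Context: Let $H=(V_H,E_H)$ be a finite simple undirected graph and let $\mathcal{E}_H$ be the set of unordered pairs $\{x,y\}$ of distinct vertices with $\{x,y\}\notin E_H$ that have a common neighbor in $H$ ("2-edges"). An extended graph $\mathcal{G}=(V,E,\mathcal{E})$ is obtained from such an $H$ by choosing $V\subseteq V_H$ and letting $E$ (resp. $\mathcal{E}$) be the pairs of $E_H$ (resp. $\mathcal{E}_H$) with both endpoints in $V$. For $U\subseteq V$, $\mathcal{G}[U]$ denotes the extended graph on $U$ keeping exactly the pairs of $E$ and of $\mathcal{E}$ with both endpoints in $U$. For $v\in V$: $N(v)=\{x:\{x,v\}\in E\}$, $N[v]=N(v)\cup\{v\}$, $N^2(v)=\{x:\{x,v\}\in\mathcal{E}\}$, $N^2[v]=N^2(v)\cup N[v]$. A 2-clique is a set $C\subseteq V$ such that any two distinct vertices of $C$ form a pair in $E\cup\mathcal{E}$. A vertex $v$ is 2-isolated if $N^2[v]$ is a 2-clique. A 2-packing set of $\mathcal{G}$ is a set $S\subseteq V$ such that no two distinct vertices of $S$ form a pair in $E\cup\mathcal{E}$; a maximum 2-packing set is one of maximum cardinality, and $\beta(\mathcal{G})$ is this maximum cardinality. -}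

module Defs where

open import Data.Nat using (ℕ; suc; _≤_)
open import Data.Bool using (Bool; true; false; T)
open import Data.Fin using (Fin)
open import Data.Fin.Subset using (Subset; _∈_; _∉_; _⊆_; ∣_∣)
open import Data.Product using (Σ; ∃; _×_; _,_)
open import Data.Sum using (_⊎_)
open import Relation.Nullary using (¬_)
open import Relation.Binary.PropositionalEquality using (_≡_; _≢_)

record SimpleGraph (n : ℕ) : Set where
  field
    adj   : Fin n → Fin n → Bool
    sym   : ∀ x y → adj x y ≡ adj y x
    irrefl : ∀ x → adj x x ≡ false

-- An extended graph: host graph H together with a chosen vertex set V ⊆ V_H.
record ExtGraph (n : ℕ) : Set where
  field
    host : SimpleGraph n
    V    : Subset n

module _ {n : ℕ} where
  open SimpleGraph
  open ExtGraph

  EdgeH : SimpleGraph n → Fin n → Fin n → Set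
  EdgeH H x y = T (adj H x y)

  TwoEdgeH : SimpleGraph n → Fin n → Fin n → Set
  TwoEdgeH H x y = x ≢ y × ¬ EdgeH H x y × ∃ λ z → EdgeH H x z × EdgeH H z y

  -- E and 𝓔 of the extended graph: pairs of E_H / 𝓔_H with both ends in V
  Edge : ExtGraph n → Fin n → Fin n → Set
  Edge G x y = x ∈ V G × y ∈ V G × EdgeH (host G) x y

  TwoEdge : ExtGraph n → Fin n → Fin n → Set
  TwoEdge G x y = x ∈ V G × y ∈ V G × TwoEdgeH (host G) x y

  Linked : ExtGraph n → Fin n → Fin n → Set
  Linked G x y = Edge G x y ⊎ TwoEdge G x y

  -- induced extended graph G[U] for U ⊆ V: keeps the pairs of E and 𝓔 with
  -- both endpoints in U (which, since U ⊆ V, is the extended graph of H on U)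
  induced : ExtGraph n → Subset n → ExtGraph n
  induced G U = record { host = host G ; V = U }

  InN : ExtGraph n → Fin n → Fin n → Set
  InN G v x = Edge G x v

  InNclosed : ExtGraph n → Fin n → Fin n → Set
  InNclosed G v x = InN G v x ⊎ x ≡ v

  InN2 : ExtGraph n → Fin n → Fin n → Set
  InN2 G v x = TwoEdge G x v

  InN2closed : ExtGraph n → Fin n → Fin n → Set
  InN2closed G v x = InN2 G v x ⊎ InNclosed G v x

  Is2Clique : ExtGraph n → (Fin n → Set) → Set
  Is2Clique G C = (∀ x → C x → x ∈ V G) ×
                  (∀ x y → C x → C y → x ≢ y → Linked G x y)

  TwoIsolated : ExtGraph n → Fin n → Set
  TwoIsolated G v = Is2Clique G (InN2closed G v)

  Is2Packing : ExtGraph n → Subset n → Set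
  Is2Packing G S = S ⊆ V G ×
                   (∀ x y → x ∈ S → y ∈ S → x ≢ y → ¬ Linked G x y)

  IsMax2Packing : ExtGraph n → Subset n → Set
  IsMax2Packing G S = Is2Packing G S × (∀ T → Is2Packing G T → ∣ T ∣ ≤ ∣ S ∣)

  IsBeta : ExtGraph n → ℕ → Set
  IsBeta G k = ∃ λ S → IsMax2Packing G S × ∣ S ∣ ≡ k

-- Take a maximum 2-packing set S. Since N²[v] is a 2-clique, S meets it in at
-- most one vertex u; replacing u by v (or just adding v when S misses N²[v])
-- yields a 2-packing set at least as large, which contains v. Given such a
-- maximum S ∋ v, the set S - v is a 2-packing set of 𝒢' = 𝒢[V ∖ N²[v]], and
-- every 2-packing set T of 𝒢' extends to the 2-packing set T ∪ {v} of 𝒢, so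
-- S - v is maximum in 𝒢' and β(𝒢) = β(𝒢') + 1.
module Submission where

open import Defs
open import Data.Nat using (ℕ; suc; zero; _≤_; z≤n; s≤s; _≤?_; s≤s⁻¹)
open import Data.Nat.Properties
  using (≤-trans; ≤-antisym; ≤-reflexive; <⇒≤; ≰⇒>; module ≤-Reasoning)
open import Data.Fin using (Fin; zero; suc; _≟_)
open import Data.Fin.Subset
  using (Subset; _∈_; _∉_; _⊆_; ∣_∣; inside; outside; ⊥; ⁅_⁆; _∪_; _-_)
open import Data.Fin.Subset.Properties
  using ( _∈?_; _⊆?_; ∉⊥; x∈⁅x⁆; x∈⁅y⁆⇒x≡y; p⊆p∪q; q⊆p∪q; x∈p∪q⁻; ∪-identityʳ
        ; p─q⊆p; x∈p∧x≢y⇒x∈p-y; p⊆q⇒∣p∣≤∣q∣; ∣p∣≤∣p∪q∣; x∈p⇒∣p-x∣<∣p∣ )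
open import Data.Fin.Properties using (any?; all?)
open import Data.Vec using ([]; _∷_; here; there)
open import Data.Bool using (T; T?)
open import Data.Product using (Σ; ∃; _×_; _,_; proj₁; proj₂)
open import Data.Sum using (_⊎_; inj₁; inj₂)
import Data.Sum as Sum
open import Function using (_∘_; id)
open import Relation.Unary using (Pred; Decidable)
open import Relation.Nullary using (¬_; Dec; yes; no; contradiction)
open import Relation.Nullary.Decidable using (¬?; _×-dec_; _→-dec_; _⊎-dec_)
open import Relation.Binary.PropositionalEquality
  using (_≡_; refl; sym; trans; subst; cong; _≢_)
open import Function.Bundles using (_⇔_; Equivalence)
open ExtGraph

x∉p-x : ∀ {n} (x : Fin n) (p : Subset n) → x ∉ p - x
x∉p-x zero    (_ ∷ p) ()
x∉p-x (suc x) (_ ∷ p) (there x∈p-x) = x∉p-x x p x∈p-x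

x∈p-y⇒x≢y : ∀ {n} {x y : Fin n} {p : Subset n} → x ∈ p - y → x ≢ y
x∈p-y⇒x≢y x∈p-y refl = x∉p-x _ _ x∈p-y

p⊆p-x∪⁅x⁆ : ∀ {n} {x : Fin n} {p : Subset n} → p ⊆ (p - x) ∪ ⁅ x ⁆
p⊆p-x∪⁅x⁆ {x = x} {p} {y} y∈p with y ≟ x
... | yes refl = q⊆p∪q _ _ (x∈⁅x⁆ x)
... | no  y≢x  = p⊆p∪q _ (x∈p∧x≢y⇒x∈p-y y∈p y≢x)

x∉p⇒∣p∪⁅x⁆∣≡1+∣p∣ : ∀ {n} {x : Fin n} {p : Subset n} → x ∉ p → ∣ p ∪ ⁅ x ⁆ ∣ ≡ suc ∣ p ∣
x∉p⇒∣p∪⁅x⁆∣≡1+∣p∣ {x = zero}  {outside ∷ p} _   = cong (suc ∘ ∣_∣) (∪-identityʳ p)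
x∉p⇒∣p∪⁅x⁆∣≡1+∣p∣ {x = zero}  {inside  ∷ p} x∉p = contradiction here x∉p
x∉p⇒∣p∪⁅x⁆∣≡1+∣p∣ {x = suc x} {outside ∷ p} x∉p = x∉p⇒∣p∪⁅x⁆∣≡1+∣p∣ (x∉p ∘ there)
x∉p⇒∣p∪⁅x⁆∣≡1+∣p∣ {x = suc x} {inside  ∷ p} x∉p = cong suc (x∉p⇒∣p∪⁅x⁆∣≡1+∣p∣ (x∉p ∘ there))

x∈p⇒∣p∣≡1+∣p-x∣ : ∀ {n} {x : Fin n} {p : Subset n} → x ∈ p → ∣ p ∣ ≡ suc ∣ p - x ∣
x∈p⇒∣p∣≡1+∣p-x∣ {x = x} {p} x∈p = ≤-antisym
  (≤-trans (p⊆q⇒∣p∣≤∣q∣ (p⊆p-x∪⁅x⁆ {x = x} {p}))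
           (≤-reflexive (x∉p⇒∣p∪⁅x⁆∣≡1+∣p∣ (x∉p-x x p))))
  (x∈p⇒∣p-x∣<∣p∣ x∈p)

Largest : ∀ {n ℓ} → Pred (Subset n) ℓ → Subset n → Set ℓ
Largest P S = P S × (∀ T → P T → ∣ T ∣ ≤ ∣ S ∣)

empty⊎∃-largest : ∀ {n ℓ} {P : Pred (Subset n) ℓ} → Decidable P →
  (∀ S → ¬ P S) ⊎ ∃ (Largest P)
empty⊎∃-largest {zero} P? with P? []
... | yes p = inj₂ ([] , p , λ { [] _ → z≤n })
... | no ¬p = inj₁ λ { [] → ¬p }
empty⊎∃-largest {suc n} P?
  with empty⊎∃-largest (P? ∘ (outside ∷_)) | empty⊎∃-largest (P? ∘ (inside ∷_))
... | inj₁ ¬out | inj₁ ¬in = inj₁ λ { (outside ∷ s) → ¬out s ; (inside ∷ s) → ¬in s }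
... | inj₁ ¬out | inj₂ (S , p , max) = inj₂ (inside ∷ S , p , λ
  { (outside ∷ t) q → contradiction q (¬out t)
  ; (inside  ∷ t) q → s≤s (max t q) })
... | inj₂ (S , p , max) | inj₁ ¬in = inj₂ (outside ∷ S , p , λ
  { (outside ∷ t) q → max t q
  ; (inside  ∷ t) q → contradiction q (¬in t) })
... | inj₂ (S , p , max) | inj₂ (S′ , p′ , max′) with ∣ S ∣ ≤? suc ∣ S′ ∣
...   | yes ∣S∣≤ = inj₂ (inside ∷ S′ , p′ , λ
  { (outside ∷ t) q → ≤-trans (max t q) ∣S∣≤
  ; (inside  ∷ t) q → s≤s (max′ t q) })
...   | no  ∣S∣≰ = inj₂ (outside ∷ S , p , λ
  { (outside ∷ t) q → max t q
  ; (inside  ∷ t) q → ≤-trans (s≤s (max′ t q)) (<⇒≤ (≰⇒> ∣S∣≰)) })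

∃-largest : ∀ {n ℓ} {P : Pred (Subset n) ℓ} → Decidable P → ∃ P → ∃ (Largest P)
∃-largest P? (S , p) with empty⊎∃-largest P?
... | inj₁ empty   = contradiction p (empty S)
... | inj₂ largest = largest

module _ {n : ℕ} (G : ExtGraph n) where

  private
    H : SimpleGraph n
    H = host G

  edgeH-sym : ∀ {x y} → EdgeH H x y → EdgeH H y x
  edgeH-sym {x} {y} = subst T (SimpleGraph.sym H x y)

  linked-sym : ∀ {x y} → Linked G x y → Linked G y x
  linked-sym (inj₁ (x∈V , y∈V , e)) = inj₁ (y∈V , x∈V , edgeH-sym e)
  linked-sym (inj₂ (x∈V , y∈V , x≢y , ¬e , z , e₁ , e₂)) =
    inj₂ (y∈V , x∈V , x≢y ∘ sym , ¬e ∘ edgeH-sym , z , edgeH-sym e₂ , edgeH-sym e₁)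

  edge? : ∀ x y → Dec (Edge G x y)
  edge? x y = x ∈? V G ×-dec y ∈? V G ×-dec T? (SimpleGraph.adj H x y)

  twoEdge? : ∀ x y → Dec (TwoEdge G x y)
  twoEdge? x y = x ∈? V G ×-dec y ∈? V G ×-dec ¬? (x ≟ y) ×-dec ¬? (T? (adj x y))
    ×-dec any? (λ z → T? (adj x z) ×-dec T? (adj z y))
    where open SimpleGraph H using (adj)

  linked? : ∀ x y → Dec (Linked G x y)
  linked? x y = edge? x y ⊎-dec twoEdge? x y

  inN2closed? : ∀ v x → Dec (InN2closed G v x)
  inN2closed? v x = twoEdge? x v ⊎-dec edge? x v ⊎-dec x ≟ v

  linked⇒inN2closed : ∀ {v x} → Linked G x v → InN2closed G v x
  linked⇒inN2closed (inj₁ e) = inj₂ (inj₁ e)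
  linked⇒inN2closed (inj₂ t) = inj₁ t

  inN2closed⇒linked : ∀ {v x} → InN2closed G v x → x ≢ v → Linked G x v
  inN2closed⇒linked (inj₁ t)          _   = inj₂ t
  inN2closed⇒linked (inj₂ (inj₁ e))   _   = inj₁ e
  inN2closed⇒linked (inj₂ (inj₂ x≡v)) x≢v = contradiction x≡v x≢v

  is2Packing? : ∀ S → Dec (Is2Packing G S)
  is2Packing? S = S ⊆? V G ×-dec all? λ x → all? λ y →
    x ∈? S →-dec y ∈? S →-dec ¬? (x ≟ y) →-dec ¬? (linked? x y)

  ⊥-is2Packing : Is2Packing G ⊥
  ⊥-is2Packing = (λ x∈⊥ → contradiction x∈⊥ ∉⊥) , λ x _ x∈⊥ _ _ _ → ∉⊥ x∈⊥

  is2Packing-⊆ : ∀ {R S} → R ⊆ S → Is2Packing G S → Is2Packing G R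
  is2Packing-⊆ R⊆S (S⊆V , sep) = S⊆V ∘ R⊆S , λ x y x∈R y∈R → sep x y (R⊆S x∈R) (R⊆S y∈R)

  is2Packing-∪⁅⁆ : ∀ {S v} → v ∈ V G → Is2Packing G S →
    (∀ {x} → x ∈ S → ¬ Linked G x v) → Is2Packing G (S ∪ ⁅ v ⁆)
  is2Packing-∪⁅⁆ {S} {v} v∈V (S⊆V , sep) far = S∪v⊆V , sep′
    where
    ∈S⊎≡v : ∀ {x} → x ∈ S ∪ ⁅ v ⁆ → x ∈ S ⊎ x ≡ v
    ∈S⊎≡v = Sum.map₂ (x∈⁅y⁆⇒x≡y v) ∘ x∈p∪q⁻ S ⁅ v ⁆
    S∪v⊆V : S ∪ ⁅ v ⁆ ⊆ V G
    S∪v⊆V x∈ with ∈S⊎≡v x∈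
    ... | inj₁ x∈S = S⊆V x∈S
    ... | inj₂ refl = v∈V
    sep′ : ∀ x y → x ∈ S ∪ ⁅ v ⁆ → y ∈ S ∪ ⁅ v ⁆ → x ≢ y → ¬ Linked G x y
    sep′ x y x∈ y∈ x≢y with ∈S⊎≡v x∈ | ∈S⊎≡v y∈
    ... | inj₁ x∈S | inj₁ y∈S = sep x y x∈S y∈S x≢y
    ... | inj₁ x∈S | inj₂ refl = far x∈S
    ... | inj₂ refl | inj₁ y∈S = far y∈S ∘ linked-sym
    ... | inj₂ refl | inj₂ refl = contradiction refl x≢y

  ∃-max2Packing : ∃ (IsMax2Packing G)
  ∃-max2Packing = ∃-largest is2Packing? (⊥ , ⊥-is2Packing)

  max2Packing-exchange : ∀ {S R v} → IsMax2Packing G S → R ⊆ S → ∣ S ∣ ≤ ∣ R ∪ ⁅ v ⁆ ∣ →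
    v ∈ V G → (∀ {x} → x ∈ R → ¬ Linked G x v) → IsMax2Packing G (R ∪ ⁅ v ⁆)
  max2Packing-exchange (pS , maxS) R⊆S ∣S∣≤ v∈V far =
    is2Packing-∪⁅⁆ v∈V (is2Packing-⊆ R⊆S pS) far , λ T pT → ≤-trans (maxS T pT) ∣S∣≤

  twoIsolated⇒∈max2Packing : ∀ {v} → v ∈ V G → TwoIsolated G v →
    ∃ λ S → IsMax2Packing G S × v ∈ S
  twoIsolated⇒∈max2Packing {v} v∈V (_ , clique) with ∃-max2Packing
  ... | S , maxS@((_ , sep) , _) with any? (λ u → u ∈? S ×-dec inN2closed? v u)
  ...   | no S∩N²[v]≡∅ =
    S ∪ ⁅ v ⁆ ,
    max2Packing-exchange maxS id (∣p∣≤∣p∪q∣ S ⁅ v ⁆) v∈V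
      (λ x∈S l → S∩N²[v]≡∅ (_ , x∈S , linked⇒inN2closed l)) ,
    q⊆p∪q S ⁅ v ⁆ (x∈⁅x⁆ v)
  ...   | yes (u , u∈S , u∈N²[v]) =
    (S - u) ∪ ⁅ v ⁆ ,
    max2Packing-exchange maxS (p─q⊆p S ⁅ u ⁆) ∣S∣≤ v∈V far ,
    q⊆p∪q (S - u) ⁅ v ⁆ (x∈⁅x⁆ v)
    where
    only-u : ∀ {x} → x ∈ S → InN2closed G v x → x ≡ u
    only-u {x} x∈S x∈N²[v] with x ≟ u
    ... | yes x≡u = x≡u
    ... | no  x≢u = contradiction (clique x u x∈N²[v] u∈N²[v] x≢u) (sep x u x∈S u∈S x≢u)
    v∉S-u : v ∉ S - u
    v∉S-u v∈S-u = x∈p-y⇒x≢y v∈S-u (only-u (p─q⊆p S ⁅ u ⁆ v∈S-u) (inj₂ (inj₂ refl)))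
    far : ∀ {x} → x ∈ S - u → ¬ Linked G x v
    far x∈S-u l = x∈p-y⇒x≢y x∈S-u (only-u (p─q⊆p S ⁅ u ⁆ x∈S-u) (linked⇒inN2closed l))
    ∣S∣≤ : ∣ S ∣ ≤ ∣ (S - u) ∪ ⁅ v ⁆ ∣
    ∣S∣≤ = ≤-reflexive (trans (x∈p⇒∣p∣≡1+∣p-x∣ u∈S) (sym (x∉p⇒∣p∪⁅x⁆∣≡1+∣p∣ v∉S-u)))

  module _ {U : Subset n} where

    linked-induced⁺ : ∀ {x y} → x ∈ U → y ∈ U → Linked G x y → Linked (induced G U) x y
    linked-induced⁺ x∈U y∈U = Sum.map (λ (_ , _ , e) → x∈U , y∈U , e) (λ (_ , _ , t) → x∈U , y∈U , t)

    linked-induced⁻ : ∀ {x y} → x ∈ V G → y ∈ V G → Linked (induced G U) x y → Linked G x y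
    linked-induced⁻ x∈V y∈V = Sum.map (λ (_ , _ , e) → x∈V , y∈V , e) (λ (_ , _ , t) → x∈V , y∈V , t)

    is2Packing-induced⁺ : ∀ {S} → S ⊆ U → Is2Packing G S → Is2Packing (induced G U) S
    is2Packing-induced⁺ S⊆U (S⊆V , sep) = S⊆U , λ x y x∈S y∈S x≢y →
      sep x y x∈S y∈S x≢y ∘ linked-induced⁻ (S⊆V x∈S) (S⊆V y∈S)

    is2Packing-induced⁻ : ∀ {S} → U ⊆ V G → Is2Packing (induced G U) S → Is2Packing G S
    is2Packing-induced⁻ U⊆V (S⊆U , sep) = U⊆V ∘ S⊆U , λ x y x∈S y∈S x≢y →
      sep x y x∈S y∈S x≢y ∘ linked-induced⁺ (S⊆U x∈S) (S⊆U y∈S)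

    max2Packing-removeN2closed : ∀ {S v} → (∀ x → (x ∈ U) ⇔ (x ∈ V G × ¬ InN2closed G v x)) →
      IsMax2Packing G S → v ∈ S → IsMax2Packing (induced G U) (S - v)
    max2Packing-removeN2closed {S} {v} U⇔ (pS@(S⊆V , sep) , maxS) v∈S =
      is2Packing-induced⁺ S-v⊆U (is2Packing-⊆ (p─q⊆p S ⁅ v ⁆) pS) , max
      where
      U⊆V : U ⊆ V G
      U⊆V = proj₁ ∘ Equivalence.to (U⇔ _)
      U∩N²[v]≡∅ : ∀ {x} → x ∈ U → ¬ InN2closed G v x
      U∩N²[v]≡∅ = proj₂ ∘ Equivalence.to (U⇔ _)
      S-v⊆U : S - v ⊆ U
      S-v⊆U {x} x∈S-v = Equivalence.from (U⇔ x)
        (S⊆V x∈S , λ x∈N²[v] → sep x v x∈S v∈S x≢v (inN2closed⇒linked x∈N²[v] x≢v))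
        where
        x∈S = p─q⊆p S ⁅ v ⁆ x∈S-v
        x≢v = x∈p-y⇒x≢y x∈S-v
      max : ∀ T → Is2Packing (induced G U) T → ∣ T ∣ ≤ ∣ S - v ∣
      max T pT@(T⊆U , _) = s≤s⁻¹ (begin
        suc ∣ T ∣      ≡⟨ x∉p⇒∣p∪⁅x⁆∣≡1+∣p∣ v∉T ⟨
        ∣ T ∪ ⁅ v ⁆ ∣  ≤⟨ maxS _ (is2Packing-∪⁅⁆ (S⊆V v∈S) (is2Packing-induced⁻ U⊆V pT) far) ⟩
        ∣ S ∣          ≡⟨ x∈p⇒∣p∣≡1+∣p-x∣ v∈S ⟩
        suc ∣ S - v ∣  ∎)
        where
        open ≤-Reasoning
        v∉T : v ∉ T
        v∉T v∈T = U∩N²[v]≡∅ (T⊆U v∈T) (inj₂ (inj₂ refl))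
        far : ∀ {x} → x ∈ T → ¬ Linked G x v
        far x∈T = U∩N²[v]≡∅ (T⊆U x∈T) ∘ linked⇒inN2closed

mainTheorem2 : ∀ {n : ℕ} (G : ExtGraph n) (v : Fin n) →
    v ∈ ExtGraph.V G → TwoIsolated G v →
    (∃ λ S → IsMax2Packing G S × v ∈ S) ×
    (∀ (U : Subset n) →
      (∀ x → (x ∈ U) ⇔ (x ∈ ExtGraph.V G × ¬ InN2closed G v x)) →
      Σ ℕ λ k → IsBeta (induced G U) k × IsBeta G (suc k))
mainTheorem2 G v v∈V isolated with twoIsolated⇒∈max2Packing G v∈V isolated
... | S , maxS , v∈S = (S , maxS , v∈S) , λ U U⇔ →
  ∣ S - v ∣ ,
  (S - v , max2Packing-removeN2closed G U⇔ maxS v∈S , refl) ,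
  (S , maxS , x∈p⇒∣p∣≡1+∣p-x∣ v∈S)
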